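{- Let $A_0$ be a finite subset of $\omega\setminus\{0\}$ and let $M\models\mathsf{ZFA}$. Then the D-graph $M_1$ of $M$ contains an $A_0$-bouquet.
   Context: The ambient metatheory is $\mathsf{ZFC}+\mathrm{Con}(\mathsf{ZFC})$. $\mathsf{ZFA}$ is $\mathsf{ZFC}$ with Foundation replaced by the Anti-Foundation Axiom (every flat system of equations $\{x=S_x\mid x\in X\}$, with $S_x\subseteq X\cup A$ for a set $A$ of sets, has a unique solution). For an $\{\in\}$-structure $M$, let $D(x,y)$ be $x\in y\wedge y\in x$; the D-graph $M_1$ is the reduct of $M$ to $\{D\}$. For $n\in\omega\setminus\{0\}$, a point $a\in M_1$ is an $n$-flower iff $M_1\models\neg D(a,a)$ and $a$ has exactly $n$ distinct $D$-neighbours. For $A\subseteq\omega\setminus\{0\}$, a point $b\in M_1$ is an $A$-bouquet iff $M_1\models\neg D(b,b)$, for every $n\in A$ there is an $n$-flower $x$ with $D(b,x)$, and for every $n\in\omega\setminus(\{0\}\cup A)$ there is no $n$-flower $x$ with $D(b,x)$. -}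

module Defs where

open import Data.Nat using (ℕ; zero; suc; _<_)
open import Data.Fin using (Fin)
open import Data.List using (List)
open import Data.List.Membership.Propositional using (_∈_)
open import Data.Product using (_×_; _,_)
open import Data.Empty using (⊥)
open import Relation.Nullary using (¬_)
open import Relation.Binary.PropositionalEquality using (_≡_)

-- The metatheory is classical (ZFC), so all
-- model-theoretic notions below are rendered via the Gödel–Gentzen
-- negative translation: atoms are double-negated, ∃ is ¬∀¬, ∨ is ¬(¬∧¬).

record Structure : Set₁ where
  field
    D   : Set
    Mem : D → D → Set

Ex : {A : Set} → (A → Set) → Set
Ex {A} P = ¬ ((x : A) → ¬ P x)

_∨̇_ : Set → Set → Set
P ∨̇ Q = ¬ (¬ P × ¬ Q)
infixr 3 _∨̇_

_⇔_ : Set → Set → Set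
P ⇔ Q = (P → Q) × (Q → P)
infix 2 _⇔_

module _ (M : Structure) where
  open Structure M

  _∈̇_ : D → D → Set
  x ∈̇ y = ¬ ¬ Mem x y

  _≐_ : D → D → Set
  x ≐ y = ¬ ¬ (x ≡ y)

  data Fm : Set where
    _∈'_ : ℕ → ℕ → Fm
    _≈'_ : ℕ → ℕ → Fm
    ⊥'   : Fm
    _⇒'_ : Fm → Fm → Fm
    ∀'   : Fm → Fm

  Env : Set
  Env = ℕ → D

  _∷ₑ_ : D → Env → Env
  (x ∷ₑ ρ) zero    = x
  (x ∷ₑ ρ) (suc n) = ρ n

  Sat : Env → Fm → Set
  Sat ρ (i ∈' j) = ρ i ∈̇ ρ j
  Sat ρ (i ≈' j) = ρ i ≐ ρ j
  Sat ρ ⊥'       = ⊥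
  Sat ρ (φ ⇒' ψ) = Sat ρ φ → Sat ρ ψ
  Sat ρ (∀' φ)   = (x : D) → Sat (x ∷ₑ ρ) φ

  IsEmpty : D → Set
  IsEmpty z = (w : D) → ¬ (w ∈̇ z)

  IsSucc : D → D → Set
  IsSucc y x = (w : D) → (w ∈̇ y ⇔ (w ∈̇ x ∨̇ w ≐ x))

  IsUPair : D → D → D → Set
  IsUPair w a b = (v : D) → (v ∈̇ w ⇔ (v ≐ a ∨̇ v ≐ b))

  IsOPair : D → D → D → Set
  IsOPair p a b = (w : D) → (w ∈̇ p ⇔ (IsUPair w a a ∨̇ IsUPair w a b))

  PairIn : D → D → D → Set
  PairIn f a b = Ex λ p → p ∈̇ f × IsOPair p a b

  IsFunOn : D → D → Set
  IsFunOn f X =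
      ((p : D) → p ∈̇ f → Ex λ x → Ex λ v → x ∈̇ X × IsOPair p x v)
    × ((x : D) → x ∈̇ X → Ex λ v → PairIn f x v)
    × ((x v v' : D) → PairIn f x v → PairIn f x v' → v ≐ v')

  IsFlatSystem : D → D → D → Set
  IsFlatSystem X A S =
      ((w : D) → ¬ (w ∈̇ X × w ∈̇ A))
    × IsFunOn S X
    × ((x sx w : D) → x ∈̇ X → PairIn S x sx → w ∈̇ sx → (w ∈̇ X ∨̇ w ∈̇ A))

  IsSolution : D → D → D → D → Set
  IsSolution X A S e =
      IsFunOn e X
    × ((x sx ex : D) → x ∈̇ X → PairIn S x sx → PairIn e x ex →
         (w : D) → (w ∈̇ ex ⇔
            ((Ex λ y → y ∈̇ sx × y ∈̇ X × PairIn e y w)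
             ∨̇ (w ∈̇ sx × w ∈̇ A))))

  Extensionality : Set
  Extensionality = (a b : D) → ((x : D) → (x ∈̇ a ⇔ x ∈̇ b)) → a ≐ b

  Pairing : Set
  Pairing = (a b : D) → Ex λ p → IsUPair p a b

  Union : Set
  Union = (a : D) → Ex λ u → (x : D) → (x ∈̇ u ⇔ (Ex λ y → y ∈̇ a × x ∈̇ y))

  Powerset : Set
  Powerset = (a : D) → Ex λ p → (x : D) →
    (x ∈̇ p ⇔ ((w : D) → w ∈̇ x → w ∈̇ a))

  Infinity : Set
  Infinity = Ex λ I → (Ex λ z → IsEmpty z × z ∈̇ I)
    × ((x : D) → x ∈̇ I → Ex λ y → IsSucc y x × y ∈̇ I)

  -- Separation schema: variable 0 of φ is x, the rest are parameters ρ
  Separation : Set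
  Separation = (φ : Fm) (ρ : Env) (a : D) → Ex λ b → (x : D) →
    (x ∈̇ b ⇔ (x ∈̇ a × Sat (x ∷ₑ ρ) φ))

  -- Replacement schema: variable 0 of φ is y, variable 1 is x,
  -- the rest are parameters ρ
  Replacement : Set
  Replacement = (φ : Fm) (ρ : Env) (a : D) →
    ((x y y' : D) → x ∈̇ a → Sat (y ∷ₑ (x ∷ₑ ρ)) φ → Sat (y' ∷ₑ (x ∷ₑ ρ)) φ → y ≐ y') →
    Ex λ b → (y : D) → (y ∈̇ b ⇔ (Ex λ x → x ∈̇ a × Sat (y ∷ₑ (x ∷ₑ ρ)) φ))

  Choice : Set
  Choice = (F : D) →
    ((x : D) → x ∈̇ F → Ex λ w → w ∈̇ x) →
    ((x y : D) → x ∈̇ F → y ∈̇ F → ¬ (x ≐ y) → (w : D) → ¬ (w ∈̇ x × w ∈̇ y)) →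
    Ex λ C → (x : D) → x ∈̇ F →
      Ex λ w → (w ∈̇ x × w ∈̇ C) × ((w' : D) → w' ∈̇ x × w' ∈̇ C → w' ≐ w)

  AFA : Set
  AFA = (X A S : D) → IsFlatSystem X A S →
      (Ex λ e → IsSolution X A S e)
    × ((e e' : D) → IsSolution X A S e → IsSolution X A S e' → e ≐ e')

  record ModelOfZFA : Set where
    field
      extensionality : Extensionality
      pairing        : Pairing
      union          : Union
      powerset       : Powerset
      infinity       : Infinity
      separation     : Separation
      replacement    : Replacement
      choice         : Choice
      afa            : AFA

  Dg : D → D → Set
  Dg x y = x ∈̇ y × y ∈̇ x

  HasExactly : ℕ → (D → Set) → Set
  HasExactly n P = Ex λ (f : Fin n → D) →
      ((i : Fin n) → P (f i))
    × ((i j : Fin n) → f i ≐ f j → i ≡ j)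
    × ((y : D) → P y → Ex λ i → y ≐ f i)

  IsFlower : ℕ → D → Set
  IsFlower n a = ¬ Dg a a × HasExactly n (Dg a)

  IsBouquet : List ℕ → D → Set
  IsBouquet A b =
      ¬ Dg b b
    × ((n : ℕ) → n ∈ A → Ex λ x → IsFlower n x × Dg b x)
    × ((n : ℕ) → 0 < n → ¬ (n ∈ A) → (x : D) → IsFlower n x → ¬ Dg b x)

-- Every finite graph is realised in M₁ as a union of connected components.  Give
-- each vertex v a label and two tags, all distinct Zermelo numerals, and solve by
-- AFA the flat system  x_v = { x_u | u adjacent to v } ∪ { tag₁ v , tag₂ v }.
-- The tags make v ↦ x_v injective, and a tag is never a D-neighbour of x_v:
-- whatever belongs to a numeral is a numeral, while x_v has two elements.
-- An A₀-bouquet is then the centre of the graph in which the centre is joined to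
-- one flower for each n ∈ A₀, that flower being joined to the petals 0 … n − 2.
module Submission where

open import Defs
open import Data.Empty using (⊥; ⊥-elim)
open import Data.Fin using (Fin; toℕ; fromℕ<; inject≤; _≟_)
import Data.Fin as Fin
open import Data.Fin.Patterns using (0F; 1F; 2F)
open import Data.Fin.Properties using (toℕ-injective; toℕ<n; toℕ-fromℕ<; toℕ-inject≤; inject≤-injective; injective⇒≤)
open import Data.List using (List; []; _∷_; _++_; map; length; lookup; allFin)
open import Data.List.Membership.Propositional using (_∈_)
open import Data.List.Membership.Propositional.Properties using (∈-map⁺; ∈-++⁺ˡ; ∈-++⁺ʳ; ∈-allFin; ∈-lookup)
open import Data.List.Relation.Unary.All using (All)
import Data.List.Relation.Unary.All as All
open import Data.List.Relation.Unary.Any using (here; there)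
import Data.List.Relation.Unary.Any as Any
open import Data.List.Relation.Unary.Any.Properties using (lookup-index)
open import Data.Nat using (ℕ; zero; suc; pred; _≤_; _<_; >-nonZero)
open import Data.Nat.ListAction using (sum)
open import Data.Nat.Properties using (suc-injective; ≤-trans; ≤-antisym; m≤m+n; m≤n+m; pred[n]≤n; suc-pred)
open import Data.Product using (_×_; _,_; proj₁; proj₂)
open import Data.Unit using (⊤; tt)
open import Function using (_∘_; id)
open import Relation.Binary.PropositionalEquality using (_≡_; _≢_; refl; sym; trans; cong; subst)
open import Relation.Nullary using (¬_; yes; no)
open import Relation.Nullary.Decidable using (decidable-stable; ¬¬-excluded-middle)
open import Relation.Nullary.Negation using (¬¬-map)

interleave₃ : ℕ → Fin 3 → ℕ
interleave₃ zero    r = toℕ r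
interleave₃ (suc m) r = suc (suc (suc (interleave₃ m r)))

interleave₃-injective : ∀ m n {r s : Fin 3} → interleave₃ m r ≡ interleave₃ n s → m ≡ n × r ≡ s
interleave₃-injective zero    zero    e = refl , toℕ-injective e
interleave₃-injective zero    (suc n) {0F} ()
interleave₃-injective zero    (suc n) {1F} ()
interleave₃-injective zero    (suc n) {2F} ()
interleave₃-injective (suc m) zero    {s = 0F} ()
interleave₃-injective (suc m) zero    {s = 1F} ()
interleave₃-injective (suc m) zero    {s = 2F} ()
interleave₃-injective (suc m) (suc n) e
  with interleave₃-injective m n (suc-injective (suc-injective (suc-injective e)))
... | refl , r≡s = refl , r≡s

interleave₃-role-clash : ∀ m n {r s : Fin 3} → r ≢ s → interleave₃ m r ≢ interleave₃ n s
interleave₃-role-clash m n r≢s e = r≢s (proj₂ (interleave₃-injective m n e))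

∈⇒≤sum : {n : ℕ} {ns : List ℕ} → n ∈ ns → n ≤ sum ns
∈⇒≤sum {ns = m ∷ ns} (here refl) = m≤m+n m (sum ns)
∈⇒≤sum {ns = m ∷ ns} (there p)   = ≤-trans (∈⇒≤sum p) (m≤n+m (sum ns) m)

membership-choice : {N B : Set} {P : N → B → Set} (xs : List N) → ((x : N) → Ex (P x)) →
  Ex λ (f : (x : N) → x ∈ xs → B) → (x : N) (x∈xs : x ∈ xs) → P x (f x x∈xs)
membership-choice []       _ k = k (λ _ ()) (λ _ ())
membership-choice (a ∷ xs) h k = h a λ b Pab → membership-choice xs h λ f Pf →
  k (λ { _ (here _) → b ; x (there x∈xs) → f x x∈xs })
    (λ { _ (here refl) → Pab ; x (there x∈xs) → Pf x x∈xs })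

finite-choice : {N B : Set} {P : N → B → Set} (xs : List N) → ((x : N) → x ∈ xs) →
  ((x : N) → Ex (P x)) → Ex λ (f : N → B) → (x : N) → P x (f x)
finite-choice xs complete h k =
  membership-choice xs h λ f Pf → k (λ x → f x (complete x)) (λ x → Pf x (complete x))

module BouquetGraph (A₀ : List ℕ) where

  size : Fin (length A₀) → ℕ
  size = lookup A₀

  data Node : Set where
    centre : Node
    flower : Fin (length A₀) → Node
    petal  : Fin (sum A₀) → Node

  Adjacent : Node → Node → Set
  Adjacent centre     (flower _) = ⊤
  Adjacent (flower _) centre     = ⊤
  Adjacent (flower i) (petal j)  = toℕ j < pred (size i)
  Adjacent (petal j)  (flower i) = toℕ j < pred (size i)
  Adjacent _          _          = ⊥

  Adjacent-sym : {u v : Node} → Adjacent u v → Adjacent v u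
  Adjacent-sym {centre}   {flower _} a = a
  Adjacent-sym {flower _} {centre}   a = a
  Adjacent-sym {flower _} {petal _}  a = a
  Adjacent-sym {petal _}  {flower _} a = a

  Adjacent-irrefl : {v : Node} → ¬ Adjacent v v
  Adjacent-irrefl {centre}   ()
  Adjacent-irrefl {flower _} ()
  Adjacent-irrefl {petal _}  ()

  nodes : List Node
  nodes = centre ∷ map flower (allFin _) ++ map petal (allFin _)

  nodes-complete : (v : Node) → v ∈ nodes
  nodes-complete centre     = here refl
  nodes-complete (flower i) = there (∈-++⁺ˡ (∈-map⁺ flower (∈-allFin i)))
  nodes-complete (petal j)  = there (∈-++⁺ʳ (map flower (allFin _)) (∈-map⁺ petal (∈-allFin j)))

  code : Node → ℕ
  code centre     = interleave₃ 0 0F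
  code (flower i) = interleave₃ (toℕ i) 1F
  code (petal j)  = interleave₃ (toℕ j) 2F

  code-injective : {u v : Node} → code u ≡ code v → u ≡ v
  code-injective {centre}   {centre}    _ = refl
  code-injective {flower i} {flower i′} e = cong flower (toℕ-injective (proj₁ (interleave₃-injective _ _ e)))
  code-injective {petal j}  {petal j′}  e = cong petal (toℕ-injective (proj₁ (interleave₃-injective _ _ e)))
  code-injective {centre}   {flower i}  e = ⊥-elim (interleave₃-role-clash 0 (toℕ i) (λ ()) e)
  code-injective {centre}   {petal j}   e = ⊥-elim (interleave₃-role-clash 0 (toℕ j) (λ ()) e)
  code-injective {flower i} {centre}    e = ⊥-elim (interleave₃-role-clash (toℕ i) 0 (λ ()) e)
  code-injective {flower i} {petal j}   e = ⊥-elim (interleave₃-role-clash (toℕ i) (toℕ j) (λ ()) e)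
  code-injective {petal j}  {centre}    e = ⊥-elim (interleave₃-role-clash (toℕ j) 0 (λ ()) e)
  code-injective {petal j}  {flower i}  e = ⊥-elim (interleave₃-role-clash (toℕ j) (toℕ i) (λ ()) e)

  petal-injective : {j j′ : Fin (sum A₀)} → petal j ≡ petal j′ → j ≡ j′
  petal-injective refl = refl

  petals-fit : (i : Fin (length A₀)) → pred (size i) ≤ sum A₀
  petals-fit i = ≤-trans pred[n]≤n (∈⇒≤sum (∈-lookup {xs = A₀} i))

  flower-neighbour : (i : Fin (length A₀)) → Fin (suc (pred (size i))) → Node
  flower-neighbour i Fin.zero    = centre
  flower-neighbour i (Fin.suc j) = petal (inject≤ j (petals-fit i))

  flower-neighbour-adjacent : (i : Fin (length A₀)) (j : Fin (suc (pred (size i)))) →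
    Adjacent (flower-neighbour i j) (flower i)
  flower-neighbour-adjacent i Fin.zero    = tt
  flower-neighbour-adjacent i (Fin.suc j) =
    subst (_< pred (size i)) (sym (toℕ-inject≤ j (petals-fit i))) (toℕ<n j)

  flower-neighbour-injective : (i : Fin (length A₀)) (j j′ : Fin (suc (pred (size i)))) →
    flower-neighbour i j ≡ flower-neighbour i j′ → j ≡ j′
  flower-neighbour-injective i Fin.zero    Fin.zero     _ = refl
  flower-neighbour-injective i (Fin.suc j) (Fin.suc j′) e =
    cong Fin.suc (inject≤-injective _ _ j j′ (petal-injective e))

  flower-neighbour-complete : (i : Fin (length A₀)) (u : Node) → Adjacent u (flower i) →
    Ex λ j → u ≡ flower-neighbour i j
  flower-neighbour-complete i centre    _  k = k Fin.zero refl
  flower-neighbour-complete i (petal j) lt k = k (Fin.suc (fromℕ< lt))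
    (cong petal (toℕ-injective (sym (trans (toℕ-inject≤ (fromℕ< lt) (petals-fit i)) (toℕ-fromℕ< lt)))))

module ZFA-Model (M : Structure) (Z : ModelOfZFA M) where
  open Structure M
  open ModelOfZFA Z

  infix 4 _∈ₘ_ _≈_
  _∈ₘ_ : D → D → Set
  _∈ₘ_ = _∈̇_ M

  _≈_ : D → D → Set
  _≈_ = _≐_ M

  ∨̇-inj₁ : {P Q : Set} → P → P ∨̇ Q
  ∨̇-inj₁ p (¬p , _) = ¬p p

  ∨̇-inj₂ : {P Q : Set} → Q → P ∨̇ Q
  ∨̇-inj₂ q (_ , ¬q) = ¬q q

  ∨̇-map : {P P′ Q Q′ : Set} → (P → P′) → (Q → Q′) → P ∨̇ Q → P′ ∨̇ Q′
  ∨̇-map f g h (¬p′ , ¬q′) = h (¬p′ ∘ f , ¬q′ ∘ g)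

  ∨̇-bind : {P P′ Q Q′ : Set} → (P → ¬ ¬ P′) → (Q → ¬ ¬ Q′) → P ∨̇ Q → P′ ∨̇ Q′
  ∨̇-bind f g h (¬p′ , ¬q′) = h ((λ p → f p ¬p′) , (λ q → g q ¬q′))

  ∨̇-elim : {P Q R : Set} → (P → R) → (Q → R) → P ∨̇ Q → ¬ ¬ R
  ∨̇-elim f g h ¬r = h (¬r ∘ f , ¬r ∘ g)

  ≈-stable : {x y : D} → ¬ ¬ (x ≈ y) → x ≈ y
  ≈-stable h x≢y = h (λ x≈y → x≈y x≢y)

  ≈-refl : {x : D} → x ≈ x
  ≈-refl x≢x = x≢x refl

  ≈-sym : {x y : D} → x ≈ y → y ≈ x
  ≈-sym x≈y y≢x = x≈y (y≢x ∘ sym)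

  ≈-trans : {x y z : D} → x ≈ y → y ≈ z → x ≈ z
  ≈-trans x≈y y≈z x≢z = x≈y λ { refl → y≈z x≢z }

  ∈-respʳ-≈ : {x y y′ : D} → x ∈ₘ y → y ≈ y′ → x ∈ₘ y′
  ∈-respʳ-≈ x∈y y≈y′ x∉y′ = y≈y′ λ { refl → x∈y x∉y′ }

  IsSetOf : D → (D → Set) → Set
  IsSetOf s P = (w : D) → (w ∈ₘ s ⇔ P w)

  IsSetOf-cong : {s : D} {P Q : D → Set} → ((w : D) → P w ⇔ Q w) → IsSetOf s P → IsSetOf s Q
  IsSetOf-cong P⇔Q hs w = proj₁ (P⇔Q w) ∘ proj₁ (hs w) , proj₂ (hs w) ∘ proj₂ (P⇔Q w)

  IsSetOf-unique : {s t : D} {P : D → Set} → IsSetOf s P → IsSetOf t P → s ≈ t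
  IsSetOf-unique {s} {t} hs ht = extensionality s t λ w →
    (λ w∈s → proj₂ (ht w) (proj₁ (hs w) w∈s)) , (λ w∈t → proj₂ (hs w) (proj₁ (ht w) w∈t))

  empty-exists : Ex (IsEmpty M)
  empty-exists k = infinity λ _ (has-empty , _) → has-empty λ z (z-empty , _) → k z z-empty

  singleton-exists : (a : D) → Ex λ s → IsSetOf s (_≈ a)
  singleton-exists a k = pairing a a λ s hs →
    k s λ w → (λ w∈s → ≈-stable (∨̇-elim id id (proj₁ (hs w) w∈s))) , proj₂ (hs w) ∘ ∨̇-inj₁

  ∪-exists : {s t : D} {P Q : D → Set} → IsSetOf s P → IsSetOf t Q →
    Ex λ u → IsSetOf u (λ w → P w ∨̇ Q w)
  ∪-exists {s} {t} hs ht k = pairing s t λ p hp → union p λ u hu → k u λ w →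
    (λ w∈u (¬P , ¬Q) → proj₁ (hu w) w∈u λ y (y∈p , w∈y) → proj₁ (hp y) y∈p
       ( (λ y≈s → y≈s λ { refl → ¬P (proj₁ (hs w) w∈y) })
       , (λ y≈t → y≈t λ { refl → ¬Q (proj₁ (ht w) w∈y) }) )) ,
    (λ P∨Q → proj₂ (hu w) λ ¬∪ → P∨Q
       ( (λ Pw → ¬∪ s (proj₂ (hp s) (∨̇-inj₁ ≈-refl) , proj₂ (hs w) Pw))
       , (λ Qw → ¬∪ t (proj₂ (hp t) (∨̇-inj₂ ≈-refl) , proj₂ (ht w) Qw)) ))

  finite-image-exists : {N : Set} (xs : List N) (g : N → D) (P : N → Set) →
    Ex λ s → IsSetOf s (λ w → Ex λ x → x ∈ xs × P x × w ≈ g x)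
  finite-image-exists []       g P k = empty-exists λ s s-empty →
    k s λ w → (λ w∈s → ⊥-elim (s-empty w w∈s)) , (λ ex → ⊥-elim (ex λ { _ (() , _) }))
  finite-image-exists (a ∷ xs) g P k = finite-image-exists xs g P λ s hs → ¬¬-excluded-middle λ
    { (yes Pa) → singleton-exists (g a) λ t ht → ∪-exists ht hs λ u hu →
        k u (IsSetOf-cong (λ w → with-head Pa , split-head) hu)
    ; (no ¬Pa) → k s (IsSetOf-cong (λ w → in-tail , not-head ¬Pa) hs) }
    where
    in-tail : {w : D} → (Ex λ x → x ∈ xs × P x × w ≈ g x) → Ex λ x → x ∈ a ∷ xs × P x × w ≈ g x
    in-tail ex ¬ex = ex λ x (x∈xs , r) → ¬ex x (there x∈xs , r)
    with-head : {w : D} → P a → w ≈ g a ∨̇ (Ex λ x → x ∈ xs × P x × w ≈ g x) →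
      Ex λ x → x ∈ a ∷ xs × P x × w ≈ g x
    with-head Pa h ¬ex = h ((λ w≈ga → ¬ex a (here refl , Pa , w≈ga)) , (λ ex → in-tail ex ¬ex))
    split-head : {w : D} → (Ex λ x → x ∈ a ∷ xs × P x × w ≈ g x) →
      w ≈ g a ∨̇ (Ex λ x → x ∈ xs × P x × w ≈ g x)
    split-head ex (¬head , ¬tail) = ex λ
      { _ (here refl , _ , w≈ga) → ¬head w≈ga
      ; x (there x∈xs , r) → ¬tail λ ¬ex → ¬ex x (x∈xs , r) }
    not-head : {w : D} → ¬ P a → (Ex λ x → x ∈ a ∷ xs × P x × w ≈ g x) →
      Ex λ x → x ∈ xs × P x × w ≈ g x
    not-head ¬Pa ex ¬ex = ex λ
      { _ (here refl , Pa , _) → ¬Pa Pa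
      ; x (there x∈xs , r) → ¬ex x (x∈xs , r) }

  ∈-upair₁ : {w a b : D} → IsUPair M w a b → a ∈ₘ w
  ∈-upair₁ hw = proj₂ (hw _) (∨̇-inj₁ ≈-refl)

  ∈-upair₂ : {w a b : D} → IsUPair M w a b → b ∈ₘ w
  ∈-upair₂ hw = proj₂ (hw _) (∨̇-inj₂ ≈-refl)

  ∈-singleton : {s a v : D} → IsUPair M s a a → v ∈ₘ s → v ≈ a
  ∈-singleton hs v∈s = ≈-stable (∨̇-elim id id (proj₁ (hs _) v∈s))

  opair-exists : (a b : D) → Ex (λ p → IsOPair M p a b)
  opair-exists a b k = pairing a a λ s hs → pairing a b λ t ht → pairing s t λ p hp → k p λ w →
    (λ w∈p → ∨̇-bind (λ w≈s → ≈-subst (≈-sym w≈s) hs) (λ w≈t → ≈-subst (≈-sym w≈t) ht)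
               (proj₁ (hp w) w∈p)) ,
    (proj₂ (hp w) ∘ ∨̇-map (λ hw → IsSetOf-unique hw hs) (λ hw → IsSetOf-unique hw ht))
    where
    ≈-subst : {x y a′ b′ : D} → x ≈ y → IsUPair M x a′ b′ → ¬ ¬ IsUPair M y a′ b′
    ≈-subst x≈y hx ¬hy = x≈y λ { refl → ¬hy hx }

  opair-first : {p a b c d : D} → IsOPair M p a b → IsOPair M p c d → a ≈ c
  opair-first {p} {a} hp hq a≢c = pairing a a λ s hs →
    ∨̇-elim ∈-upair₁ ∈-upair₁ (proj₁ (hq s) (proj₂ (hp s) (∨̇-inj₁ hs)))
      λ c∈s → ∈-singleton hs c∈s (a≢c ∘ sym)

  opair-second-or : {p a b d : D} → IsOPair M p a b → IsOPair M p a d → b ≈ a ∨̇ b ≈ d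
  opair-second-or {p} {a} {b} hp hq (b≉a , b≉d) = pairing a b λ t ht →
    proj₁ (hq t) (proj₂ (hp t) (∨̇-inj₂ ht))
      ( (λ t-single → b≉a (∈-singleton t-single (∈-upair₂ ht)))
      , (λ t-pair → proj₁ (t-pair b) (∈-upair₂ ht) (b≉a , b≉d)) )

  opair-injective : {p a b c d : D} → IsOPair M p a b → IsOPair M p c d → a ≈ c × b ≈ d
  opair-injective hp hq = a≈c , λ b≢d → a≈c λ { refl → second hp hq b≢d }
    where
    a≈c = opair-first hp hq
    second : {p a b d : D} → IsOPair M p a b → IsOPair M p a d → b ≈ d
    second hp hq = ≈-stable (∨̇-elim
      (λ b≈a → ≈-stable (∨̇-elim (λ d≈a → ≈-trans b≈a (≈-sym d≈a)) ≈-sym (opair-second-or hq hp)))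
      id (opair-second-or hp hq))

  HasExactly-≤ : {P : D → Set} {m n : ℕ} → HasExactly M m P → HasExactly M n P → ¬ ¬ (m ≤ n)
  HasExactly-≤ {m = m} hm hn m≰n = hm λ f (f-P , f-injective , _) → hn λ g (_ , _ , g-onto) →
    finite-choice (allFin m) ∈-allFin (λ i → g-onto (f i) (f-P i)) λ h fi≈g[hi] →
      m≰n (injective⇒≤ λ {i} {j} hi≡hj → f-injective i j
        (≈-trans (fi≈g[hi] i) (subst (λ z → g z ≈ f j) (sym hi≡hj) (≈-sym (fi≈g[hi] j)))))

  HasExactly-unique : {P : D → Set} {m n : ℕ} → HasExactly M m P → HasExactly M n P → ¬ ¬ (m ≡ n)
  HasExactly-unique hm hn m≢n =
    HasExactly-≤ hm hn λ m≤n → HasExactly-≤ hn hm λ n≤m → m≢n (≤-antisym m≤n n≤m)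

  IsNumeral : ℕ → D → Set
  IsNumeral zero    x = IsEmpty M x
  IsNumeral (suc j) x = Ex λ y → IsNumeral j y × IsSetOf x (_≈ y)

  numeral-exists : (j : ℕ) → Ex (IsNumeral j)
  numeral-exists zero    = empty-exists
  numeral-exists (suc j) k = numeral-exists j λ y hy → singleton-exists y λ s hs → k s λ k′ → k′ y (hy , hs)

  numeral-injective : (i j : ℕ) {x y : D} → IsNumeral i x → IsNumeral j y → x ≈ y → ¬ ¬ (i ≡ j)
  numeral-injective zero    zero    _       _       _   i≢j = i≢j refl
  numeral-injective zero    (suc j) x-empty y-single x≈y _ = y-single λ y′ (_ , hy) →
    x≈y λ { refl → x-empty y′ (proj₂ (hy y′) ≈-refl) }
  numeral-injective (suc i) zero    x-single y-empty x≈y _ = x-single λ x′ (_ , hx) →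
    x≈y λ { refl → y-empty x′ (proj₂ (hx x′) ≈-refl) }
  numeral-injective (suc i) (suc j) x-single y-single x≈y i≢j =
    x-single λ x′ (x′-numeral , hx) → y-single λ y′ (y′-numeral , hy) → x≈y λ { refl →
      numeral-injective i j x′-numeral y′-numeral (proj₁ (hy x′) (proj₂ (hx x′) ≈-refl))
        λ { refl → i≢j refl } }

  numeral-subsingleton : (j : ℕ) {x w w′ : D} → IsNumeral j x → w ∈ₘ x → w′ ∈ₘ x → w ≈ w′
  numeral-subsingleton zero    x-empty  w∈x _ _ = x-empty _ w∈x
  numeral-subsingleton (suc j) x-single w∈x w′∈x w≢w′ = x-single λ _ (_ , hx) →
    ≈-trans (proj₁ (hx _) w∈x) (≈-sym (proj₁ (hx _) w′∈x)) w≢w′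

  ∈-numeral⇒numeral : (j : ℕ) {x w : D} → IsNumeral j x → w ∈ₘ x → Ex λ i → IsNumeral i w
  ∈-numeral⇒numeral zero    x-empty  w∈x _ = x-empty _ w∈x
  ∈-numeral⇒numeral (suc j) x-single w∈x k = x-single λ y (y-numeral , hx) →
    proj₁ (hx _) w∈x λ { refl → k j y-numeral }

  module Realization {N : Set} (nodes : List N) (nodes-complete : (x : N) → x ∈ nodes)
    (code : N → ℕ) (code-injective : {x y : N} → code x ≡ code y → x ≡ y)
    (E : N → N → Set) (E-sym : {u v : N} → E u v → E v u) where

    record IsRealization (ev : N → D) : Set where
      field
        injective : (x y : N) → ev x ≈ ev y → ¬ ¬ (x ≡ y)
        edge⇒Dg   : {u v : N} → E u v → Dg M (ev v) (ev u)
        Dg⇒edge   : (v : N) (w : D) → Dg M (ev v) w → Ex λ u → E u v × w ≈ ev u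

    image-exists : (g : N → D) (P : N → Set) → Ex λ s → IsSetOf s (λ w → Ex λ x → P x × w ≈ g x)
    image-exists g P k = finite-image-exists nodes g P λ s hs →
      k s (IsSetOf-cong (λ w → forget-membership , add-membership) hs)
      where
      forget-membership : {w : D} → (Ex λ x → x ∈ nodes × P x × w ≈ g x) → Ex λ x → P x × w ≈ g x
      forget-membership ex ¬ex = ex λ x (_ , r) → ¬ex x r
      add-membership : {w : D} → (Ex λ x → P x × w ≈ g x) → Ex λ x → x ∈ nodes × P x × w ≈ g x
      add-membership ex ¬ex = ex λ x r → ¬ex x (nodes-complete x , r)

    module Tagged (numeral : Fin 3 → N → D)
      (isNumeral : (r : Fin 3) (v : N) → IsNumeral (interleave₃ (code v) r) (numeral r v)) where

      label tag₁ tag₂ : N → D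
      label = numeral 0F
      tag₁  = numeral 1F
      tag₂  = numeral 2F

      numeral-distinct : {r s : Fin 3} {x y : N} → numeral r x ≈ numeral s y → ¬ ¬ (r ≡ s × x ≡ y)
      numeral-distinct {r} {s} {x} {y} e k = numeral-injective _ _ (isNumeral r x) (isNumeral s y) e
        λ c → let (code≡ , r≡s) = interleave₃-injective (code x) (code y) c
              in k (r≡s , code-injective code≡)

      numeral-role-clash : {r s : Fin 3} {x y : N} → r ≢ s → ¬ (numeral r x ≈ numeral s y)
      numeral-role-clash r≢s e = numeral-distinct e (r≢s ∘ proj₁)

      numeral-node-injective : {r : Fin 3} {x y : N} → numeral r x ≈ numeral r y → ¬ ¬ (x ≡ y)
      numeral-node-injective e = ¬¬-map proj₂ (numeral-distinct e)

      -- label v is the indeterminate x_v, the tags are the parameters, and S is the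
      -- graph { ⟨ label v , Sₓ v ⟩ } of the system.
      record FlatSystem : Set where
        field
          X A S      : D
          Sₓ pair    : N → D
          X-elements : IsSetOf X λ w → Ex λ v → ⊤ × w ≈ label v
          A-elements : IsSetOf A λ w → (Ex λ v → ⊤ × w ≈ tag₁ v) ∨̇ (Ex λ v → ⊤ × w ≈ tag₂ v)
          Sₓ-elements : (v : N) → IsSetOf (Sₓ v) λ w →
            (Ex λ u → E u v × w ≈ label u) ∨̇ (w ≈ tag₁ v ∨̇ w ≈ tag₂ v)
          pair-is    : (v : N) → IsOPair M (pair v) (label v) (Sₓ v)
          S-elements : IsSetOf S λ p → Ex λ v → ⊤ × p ≈ pair v

      flat-system-exists : ¬ ¬ FlatSystem
      flat-system-exists k =
        image-exists label (λ _ → ⊤) λ X hX →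
        image-exists tag₁ (λ _ → ⊤) λ A₁ hA₁ → image-exists tag₂ (λ _ → ⊤) λ A₂ hA₂ →
        ∪-exists hA₁ hA₂ λ A hA →
        finite-choice nodes nodes-complete equation-exists λ Sₓ hSₓ →
        finite-choice nodes nodes-complete (λ v → opair-exists (label v) (Sₓ v)) λ pair hpair →
        image-exists pair (λ _ → ⊤) λ S hS →
        k (record { X = X ; A = A ; S = S ; Sₓ = Sₓ ; pair = pair ; X-elements = hX ; A-elements = hA
                  ; Sₓ-elements = hSₓ ; pair-is = hpair ; S-elements = hS })
        where
        equation-exists : (v : N) → Ex λ s → IsSetOf s λ w →
          (Ex λ u → E u v × w ≈ label u) ∨̇ (w ≈ tag₁ v ∨̇ w ≈ tag₂ v)
        equation-exists v k′ = image-exists label (λ u → E u v) λ s₁ h₁ →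
          pairing (tag₁ v) (tag₂ v) λ s₂ h₂ → ∪-exists h₁ h₂ k′

      module System (F : FlatSystem) where
        open FlatSystem F

        ≈label⇒∈X : {w : D} {v : N} → w ≈ label v → w ∈ₘ X
        ≈label⇒∈X {v = v} w≈label = proj₂ (X-elements _) λ ¬ex → ¬ex v (tt , w≈label)

        label∈X : (v : N) → label v ∈ₘ X
        label∈X v = ≈label⇒∈X ≈-refl

        tag⇒∈A : {w : D} {v : N} → w ≈ tag₁ v ∨̇ w ≈ tag₂ v → w ∈ₘ A
        tag⇒∈A {v = v} = proj₂ (A-elements _) ∘ ∨̇-map (λ e ¬ex → ¬ex v (tt , e)) (λ e ¬ex → ¬ex v (tt , e))

        X∩A-empty : (w : D) → ¬ (w ∈ₘ X × w ∈ₘ A)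
        X∩A-empty w (w∈X , w∈A) = proj₁ (X-elements w) w∈X λ u (_ , w≈label) →
          proj₁ (A-elements w) w∈A
            ( (λ ex → ex λ v (_ , w≈tag) → numeral-role-clash (λ ()) (≈-trans (≈-sym w≈label) w≈tag))
            , (λ ex → ex λ v (_ , w≈tag) → numeral-role-clash (λ ()) (≈-trans (≈-sym w≈label) w≈tag)) )

        label∈Sₓ : {u v : N} → E u v → label u ∈ₘ Sₓ v
        label∈Sₓ {u} {v} Euv = proj₂ (Sₓ-elements v _) (∨̇-inj₁ λ ¬ex → ¬ex u (Euv , ≈-refl))

        Sₓ∩X : {v : N} {y : D} → y ∈ₘ Sₓ v → y ∈ₘ X → Ex λ u → E u v × y ≈ label u
        Sₓ∩X {v} {y} y∈Sₓ y∈X ¬ex = proj₁ (Sₓ-elements v y) y∈Sₓ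
          ((λ ex → ex ¬ex) , λ is-tag → X∩A-empty y (y∈X , tag⇒∈A is-tag))

        Sₓ∩A : {v : N} {w : D} → w ∈ₘ Sₓ v → w ∈ₘ A → w ≈ tag₁ v ∨̇ w ≈ tag₂ v
        Sₓ∩A {v} {w} w∈Sₓ w∈A ¬tag = proj₁ (Sₓ-elements v w) w∈Sₓ
          ( (λ ex → ex λ u (_ , w≈label) → X∩A-empty w (≈label⇒∈X w≈label , w∈A))
          , (λ is-tag → is-tag ¬tag) )

        S-at-label : (v : N) → PairIn M S (label v) (Sₓ v)
        S-at-label v k = k (pair v) (proj₂ (S-elements _) (λ ¬ex → ¬ex v (tt , ≈-refl)) , pair-is v)

        PairIn-S : {x s : D} → PairIn M S x s → Ex λ v → x ≈ label v × s ≈ Sₓ v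
        PairIn-S pin k = pin λ p (p∈S , p-pair) → proj₁ (S-elements p) p∈S λ v (_ , p≈pair) →
          p≈pair λ { refl → k v (opair-injective p-pair (pair-is v)) }

        isFlat : IsFlatSystem M X A S
        isFlat = X∩A-empty , (S-pairs , S-total , S-functional) , S-closed
          where
          S-pairs : (p : D) → p ∈ₘ S → Ex λ x → Ex λ s → x ∈ₘ X × IsOPair M p x s
          S-pairs p p∈S k = proj₁ (S-elements p) p∈S λ v (_ , p≈pair) →
            p≈pair λ { refl → k (label v) λ k′ → k′ (Sₓ v) (label∈X v , pair-is v) }
          S-total : (x : D) → x ∈ₘ X → Ex λ s → PairIn M S x s
          S-total x x∈X k = proj₁ (X-elements x) x∈X λ v (_ , x≈label) →
            x≈label λ { refl → k (Sₓ v) (S-at-label v) }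
          S-functional : (x s s′ : D) → PairIn M S x s → PairIn M S x s′ → s ≈ s′
          S-functional x s s′ pin pin′ s≢s′ =
            PairIn-S pin λ v (x≈label , s≈Sₓ) → PairIn-S pin′ λ v′ (x≈label′ , s′≈Sₓ) →
              numeral-node-injective (≈-trans (≈-sym x≈label) x≈label′)
                λ { refl → ≈-trans s≈Sₓ (≈-sym s′≈Sₓ) s≢s′ }
          S-closed : (x s w : D) → x ∈ₘ X → PairIn M S x s → w ∈ₘ s → w ∈ₘ X ∨̇ w ∈ₘ A
          S-closed x s w _ pin w∈s ¬both = PairIn-S pin λ v (_ , s≈Sₓ) → s≈Sₓ λ { refl →
            ∨̇-map (λ ex ¬w∈X → ex λ u (_ , w≈label) → ≈label⇒∈X w≈label ¬w∈X) tag⇒∈A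
              (proj₁ (Sₓ-elements v w) w∈s) ¬both }

        module Solution (e : D) (sol : IsSolution M X A S e) (ev : N → D)
          (ev-value : (v : N) → PairIn M e (label v) (ev v)) where

          ev-unique : {v : N} {w : D} → PairIn M e (label v) w → w ≈ ev v
          ev-unique {v} {w} pin = proj₂ (proj₂ (proj₁ sol)) (label v) w (ev v) pin (ev-value v)

          ∈-ev : (v : N) (w : D) →
            w ∈ₘ ev v ⇔ ((Ex λ u → E u v × w ≈ ev u) ∨̇ (w ≈ tag₁ v ∨̇ w ≈ tag₂ v))
          ∈-ev v w =
            ∨̇-map from-labels (λ (w∈Sₓ , w∈A) → Sₓ∩A w∈Sₓ w∈A) ∘ proj₁ equation ,
            proj₂ equation ∘ ∨̇-map to-labels (λ is-tag → proj₂ (Sₓ-elements v w) (∨̇-inj₂ is-tag) , tag⇒∈A is-tag)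
            where
            equation = proj₂ sol (label v) (Sₓ v) (ev v) (label∈X v) (S-at-label v) (ev-value v) w
            from-labels : (Ex λ y → y ∈ₘ Sₓ v × y ∈ₘ X × PairIn M e y w) → Ex λ u → E u v × w ≈ ev u
            from-labels ex ¬ex = ex λ y (y∈Sₓ , y∈X , pin) → Sₓ∩X y∈Sₓ y∈X λ u (Euv , y≈label) →
              y≈label λ { refl → ¬ex u (Euv , ev-unique pin) }
            to-labels : (Ex λ u → E u v × w ≈ ev u) → Ex λ y → y ∈ₘ Sₓ v × y ∈ₘ X × PairIn M e y w
            to-labels ex ¬ex = ex λ u (Euv , w≈ev) →
              w≈ev λ { refl → ¬ex (label u) (label∈Sₓ Euv , label∈X u , ev-value u) }

          neighbour∈ev : {u v : N} → E u v → ev u ∈ₘ ev v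
          neighbour∈ev {u} Euv = proj₂ (∈-ev _ _) (∨̇-inj₁ λ ¬ex → ¬ex u (Euv , ≈-refl))

          tag₁∈ev : (v : N) → tag₁ v ∈ₘ ev v
          tag₁∈ev v = proj₂ (∈-ev v _) (∨̇-inj₂ (∨̇-inj₁ ≈-refl))

          tag₂∈ev : (v : N) → tag₂ v ∈ₘ ev v
          tag₂∈ev v = proj₂ (∈-ev v _) (∨̇-inj₂ (∨̇-inj₂ ≈-refl))

          ev-not-numeral : (j : ℕ) (v : N) → ¬ IsNumeral j (ev v)
          ev-not-numeral j v hj =
            numeral-role-clash (λ ()) (numeral-subsingleton j hj (tag₁∈ev v) (tag₂∈ev v))

          numeral≉ev : {j : ℕ} {x : D} {v : N} → IsNumeral j x → ¬ (x ≈ ev v)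
          numeral≉ev {v = v} hx x≈ev = x≈ev λ x≡ev → ev-not-numeral _ v (subst (IsNumeral _) x≡ev hx)

          isRealization : IsRealization ev
          isRealization = record { injective = injective ; edge⇒Dg = edge⇒Dg ; Dg⇒edge = Dg⇒edge }
            where
            injective : (x y : N) → ev x ≈ ev y → ¬ ¬ (x ≡ y)
            injective x y ev≈ev x≢y = proj₁ (∈-ev y (tag₁ x)) (∈-respʳ-≈ (tag₁∈ev x) ev≈ev)
              ( (λ ex → ex λ u (_ , tag≈ev) → numeral≉ev (isNumeral 1F x) tag≈ev)
              , (λ is-tag → is-tag ((λ e → numeral-node-injective e x≢y) , numeral-role-clash (λ ()))) )
            edge⇒Dg : {u v : N} → E u v → Dg M (ev v) (ev u)
            edge⇒Dg Euv = neighbour∈ev (E-sym Euv) , neighbour∈ev Euv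
            Dg⇒edge : (v : N) (w : D) → Dg M (ev v) w → Ex λ u → E u v × w ≈ ev u
            Dg⇒edge v w (ev∈w , w∈ev) ¬ex = proj₁ (∈-ev v w) w∈ev
              ((λ ex → ex ¬ex) , λ is-tag → is-tag (not-tag 1F , not-tag 2F))
              where
              not-tag : (r : Fin 3) → ¬ (w ≈ numeral r v)
              not-tag r w≈tag = w≈tag λ w≡tag →
                ∈-numeral⇒numeral _ (isNumeral r v) (subst (ev v ∈ₘ_) w≡tag ev∈w) λ j hj → ev-not-numeral j v hj

        solution-realizes : Ex IsRealization
        solution-realizes k = proj₁ (afa X A S isFlat) λ e sol →
          finite-choice nodes nodes-complete (λ v → proj₁ (proj₂ (proj₁ sol)) (label v) (label∈X v))
            λ ev ev-value → k ev (Solution.isRealization e sol ev ev-value)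

    realization-exists : Ex IsRealization
    realization-exists k =
      finite-choice (allFin 3) ∈-allFin
        (λ r → finite-choice nodes nodes-complete λ v → numeral-exists (interleave₃ (code v) r))
        λ numeral isNumeral → Tagged.flat-system-exists numeral isNumeral λ F →
          Tagged.System.solution-realizes numeral isNumeral F k

    module _ {ev : N → D} (R : IsRealization ev) where
      open IsRealization R

      ¬Dg-self : {v : N} → ¬ E v v → ¬ Dg M (ev v) (ev v)
      ¬Dg-self {v} ¬Evv d =
        Dg⇒edge v (ev v) d λ u (Euv , ev≈ev) → injective v u ev≈ev λ { refl → ¬Evv Euv }

      neighbours-counted : {n : ℕ} (v : N) (g : Fin n → N) → ((i : Fin n) → E (g i) v) →
        ((i j : Fin n) → g i ≡ g j → i ≡ j) → ((u : N) → E u v → Ex λ i → u ≡ g i) →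
        HasExactly M n (Dg M (ev v))
      neighbours-counted v g g-adjacent g-injective g-complete k =
        k (ev ∘ g) ((λ i → edge⇒Dg (g-adjacent i)) , ev∘g-injective , covered)
        where
        ev∘g-injective : (i j : Fin _) → ev (g i) ≈ ev (g j) → i ≡ j
        ev∘g-injective i j e = decidable-stable (i ≟ j) (¬¬-map (g-injective i j) (injective _ _ e))
        covered : (w : D) → Dg M (ev v) w → Ex λ i → w ≈ ev (g i)
        covered w d k′ = Dg⇒edge v w d λ u (Euv , w≈ev) →
          g-complete u Euv λ i u≡gi → k′ i (subst (λ z → w ≈ ev z) u≡gi w≈ev)

  module _ (A₀ : List ℕ) (A₀-positive : All (0 <_) A₀) where
    open BouquetGraph A₀
    open Realization nodes nodes-complete code code-injective Adjacent Adjacent-sym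

    module _ {ev : Node → D} (R : IsRealization ev) where
      open IsRealization R

      flower-isFlower : (i : Fin (length A₀)) → IsFlower M (size i) (ev (flower i))
      flower-isFlower i = ¬Dg-self R (Adjacent-irrefl {flower i}) ,
        subst (λ n → HasExactly M n (Dg M (ev (flower i))))
          (suc-pred (size i) {{>-nonZero (All.lookup A₀-positive (∈-lookup i))}})
          (neighbours-counted R (flower i) (flower-neighbour i) (flower-neighbour-adjacent i)
            (flower-neighbour-injective i) (flower-neighbour-complete i))

      centre-isBouquet : IsBouquet M A₀ (ev centre)
      centre-isBouquet = ¬Dg-self R (Adjacent-irrefl {centre}) , flowers-present , others-absent
        where
        flowers-present : (n : ℕ) → n ∈ A₀ → Ex λ x → IsFlower M n x × Dg M (ev centre) x
        flowers-present n n∈A₀ k = k (ev (flower i))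
          (subst (λ m → IsFlower M m (ev (flower i))) (sym (lookup-index n∈A₀)) (flower-isFlower i) ,
           edge⇒Dg {flower i} {centre} tt)
          where i = Any.index n∈A₀
        sizes-in-A₀ : {n : ℕ} {x : D} (u : Node) → Adjacent u centre →
          IsFlower M n x → x ≈ ev u → ¬ ¬ (n ∈ A₀)
        sizes-in-A₀ (flower i) _ x-flower x≈ev n∉A₀ = x≈ev λ { refl →
          HasExactly-unique (proj₂ x-flower) (proj₂ (flower-isFlower i))
            λ n≡size → n∉A₀ (subst (_∈ A₀) (sym n≡size) (∈-lookup i)) }
        others-absent : (n : ℕ) → 0 < n → ¬ (n ∈ A₀) → (x : D) → IsFlower M n x → ¬ Dg M (ev centre) x
        others-absent n _ n∉A₀ x x-flower d =
          Dg⇒edge centre x d λ u (adjacent , x≈ev) → sizes-in-A₀ u adjacent x-flower x≈ev n∉A₀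

    bouquet-exists : Ex (IsBouquet M A₀)
    bouquet-exists k = realization-exists λ ev R → k (ev centre) (centre-isBouquet R)

lemma3p2 : (A₀ : List ℕ) → All (0 <_) A₀ → (M : Structure) → ModelOfZFA M →
    Ex (λ b → IsBouquet M A₀ b)
lemma3p2 A₀ A₀-positive M Z = ZFA-Model.bouquet-exists M Z A₀ A₀-positive
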